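{- Let $0\le m<n$ be integers. If $s(x)$ is a complex polynomial of degree $n-m-1$, then $$\tilde U_n\,s(x)=(1-x)^m\frac{(n-m)!}{n!}\,\tilde U_{n-m}\,s(x).$$ Respectively, if $c(x)$ is a complex polynomial of degree $<n-m$, then $$\tilde U_n^{ -1}\big((1-x)^m c(x)\big)=\frac{n!}{(n-m)!}\,\tilde U_{n-m}^{ -1}c(x).$$
   Context: The Euler polynomials $A_k(x)$ are defined by $\frac{A_k(x)}{(1-x)^{k+1}}=\sum_{m\ge0}m^kx^m$, and $\tilde A_k(x)=A_k(x)/x$ for $k\ge1$. For an integer $N\ge1$, $\tilde U_N$ is the linear operator on the space $\mathcal P_{N-1}$ of polynomials of degree at most $N-1$ with $\tilde U_N x^p=\frac{1}{N!}(1-x)^{N-1-p}\tilde A_{p+1}(x)$, $p=0,\dots,N-1$; it is invertible, with $\tilde U_N^{ -1}x^p=(x-1)_p[x+1]_{N-p-1}$, where $(\varphi)_k=\varphi(\varphi-1)\cdots(\varphi-k+1)$ and $[\varphi]_k=\varphi(\varphi+1)\cdots(\varphi+k-1)$, both equal to $1$ for $k=0$. -}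

module Defs where

open import Algebra.Bundles using (CommutativeRing)
open import Data.Nat as ℕ using (ℕ; zero; suc; _∸_; _<_; _≤_; _!)
open import Data.Nat.Combinatorics using (_C_)
open import Data.List using (List; []; _∷_; map; foldr; upTo; drop)
open import Data.Product using (_×_)
open import Relation.Nullary using (¬_)

-- Polynomials over a commutative ring R, as coefficient lists (lowest degree
-- first), compared coefficientwise (so trailing zeros are irrelevant).
-- `recip k` is meant to be an inverse of (k+1)·1 in R (the hypothesis is
-- imposed in the theorem); it is only used to form 1/N!.
module Poly {c ℓ} (R : CommutativeRing c ℓ) (recip : ℕ → CommutativeRing.Carrier R) where
  open CommutativeRing R

  Pol : Set c
  Pol = List Carrier

  coeff : Pol → ℕ → Carrier
  coeff []      _       = 0#
  coeff (a ∷ p) zero    = a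
  coeff (a ∷ p) (suc i) = coeff p i

  infix 4 _≈ₚ_
  _≈ₚ_ : Pol → Pol → Set ℓ
  p ≈ₚ q = ∀ i → coeff p i ≈ coeff q i

  infixl 6 _+ₚ_
  _+ₚ_ : Pol → Pol → Pol
  []      +ₚ q       = q
  (a ∷ p) +ₚ []      = a ∷ p
  (a ∷ p) +ₚ (b ∷ q) = (a + b) ∷ (p +ₚ q)

  infixr 7 _·ₚ_
  _·ₚ_ : Carrier → Pol → Pol
  a ·ₚ p = map (a *_) p

  infixl 7 _*ₚ_
  _*ₚ_ : Pol → Pol → Pol
  []      *ₚ q = []
  (a ∷ p) *ₚ q = (a ·ₚ q) +ₚ (0# ∷ (p *ₚ q))

  oneₚ : Pol
  oneₚ = 1# ∷ []

  infixr 8 _^ₚ_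
  _^ₚ_ : Pol → ℕ → Pol
  p ^ₚ zero  = oneₚ
  p ^ₚ suc k = p *ₚ (p ^ₚ k)

  ι : ℕ → Carrier
  ι zero    = 0#
  ι (suc n) = 1# + ι n

  sgn : ℕ → Carrier
  sgn zero    = 1#
  sgn (suc i) = - (sgn i)

  Σ< : ℕ → (ℕ → Carrier) → Carrier
  Σ< n f = foldr (λ i acc → f i + acc) 0# (upTo n)

  Σₚ< : ℕ → (ℕ → Pol) → Pol
  Σₚ< n f = foldr (λ i acc → f i +ₚ acc) [] (upTo n)

  Πₚ< : ℕ → (ℕ → Pol) → Pol
  Πₚ< n f = foldr (λ j acc → f j *ₚ acc) oneₚ (upTo n)

  oneMinusX : Pol
  oneMinusX = 1# ∷ (- 1#) ∷ []

  xPlus : Carrier → Pol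
  xPlus a = a ∷ 1# ∷ []

  invfact : ℕ → Carrier
  invfact zero    = 1#
  invfact (suc n) = recip n * invfact n

  -- Coefficient of x^j in (1-x)^{k+1} · Σ_{m≥0} m^k x^m  (Cauchy product),
  -- i.e. Σ_{i=0}^{j} (-1)^i C(k+1,i) (j-i)^k   (with 0^0 = 1).
  eulerCoeff : ℕ → ℕ → Carrier
  eulerCoeff k j = Σ< (suc j) (λ i → sgn i * (ι ((suc k) C i) * ι ((j ∸ i) ℕ.^ k)))

  -- Euler polynomial A_k(x) = (1-x)^{k+1} Σ_m m^k x^m, which has degree ≤ k.
  A : ℕ → Pol
  A k = map (eulerCoeff k) (upTo (suc k))

  -- Ã_k(x) = A_k(x)/x  (k ≥ 1, where A_k(0) = 0)
  Ã : ℕ → Pol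
  Ã k = drop 1 (A k)

  -- Ũ_N on P_{N-1}:  x^p ↦ (1/N!) (1-x)^{N-1-p} Ã_{p+1}(x)
  U : ℕ → Pol → Pol
  U N s = Σₚ< N (λ p → coeff s p ·ₚ (invfact N ·ₚ ((oneMinusX ^ₚ (N ∸ 1 ∸ p)) *ₚ Ã (suc p))))

  falling : ℕ → Pol
  falling p = Πₚ< p (λ j → xPlus (- ι (suc j)))

  rising : ℕ → Pol
  rising k = Πₚ< k (λ j → xPlus (ι (suc j)))

  -- Ũ_N^{-1} on P_{N-1}:  x^p ↦ (x-1)_p [x+1]_{N-p-1}
  Uinv : ℕ → Pol → Pol
  Uinv N s = Σₚ< N (λ p → coeff s p ·ₚ (falling p *ₚ rising (N ∸ p ∸ 1)))

  HasDegree : Pol → ℕ → Set ℓ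
  HasDegree p d = (¬ (coeff p d ≈ 0#)) × (∀ i → d < i → coeff p i ≈ 0#)

  DegLt : Pol → ℕ → Set ℓ
  DegLt p k = ∀ i → k ≤ i → coeff p i ≈ 0#

module Submission where

--  * Ũ: for deg s < N only the terms p < N of Ũ_{m+N} s survive, and in each of
--    them (1-x)^{m+N-1-p} = (1-x)^m (1-x)^{N-1-p}; so (1-x)^m factors out of the
--    sum, leaving Ũ_N s up to the constant N!/(m+N)!.
--  * Ũ⁻¹: by induction on m it suffices to show
--        Ũ_{N+1}⁻¹((1-x) d) = (N+1) Ũ_N⁻¹ d        for deg d < N.
--    The coefficients of (1-x) d are the differences d_p - d_{p-1}, so the left
--    side is an Abel (summation by parts) sum, and the basis polynomials
--    g_M(p) = (x-1)_p [x+1]_{M-p-1} satisfy g_{N+1}(p) - g_{N+1}(p+1) = (N+1) g_N(p).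

open import Defs
open import Algebra.Bundles using (CommutativeRing)
open import Data.Nat using (ℕ; suc; _∸_; _<_; _!)
open import Data.Product using (_×_; Σ-syntax; _,_; proj₂)
open import Data.Nat as ℕ using (zero; _≤_; z≤n; s≤s)
open import Data.Nat.Properties using (m+n∸m≡n; +-∸-assoc; ∸-+-assoc; ≤-refl; m≤n⇒m≤1+n; m≤n+m)
open import Data.List using ([]; _∷_; foldr; applyUpTo)
open import Function using (_∘_)
open import Relation.Binary.Bundles using (Setoid)
open import Relation.Binary.PropositionalEquality as ≡ using (_≡_)
import Relation.Binary.Reasoning.Setoid as SetoidReasoning
import Algebra.Properties.CommutativeSemigroup as CommutativeSemigroupProperties

module Development {c ℓ} (R : CommutativeRing c ℓ) (recip : ℕ → CommutativeRing.Carrier R) where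
  open CommutativeRing R
  open Poly R recip
  open import Algebra.Bundles using (CommutativeMonoid)
  open import Algebra.Properties.Ring ring using (-1*x≈-x)
  open import Algebra.Solver.Ring.NaturalCoefficients.Default commutativeSemiring
    using (solve; _:+_; _:*_; _:=_)

  module ≈-Reasoning = SetoidReasoning setoid

  -- Coefficientwise equality, wrapped in a record so that a proof determines
  -- both polynomials (the bare function type p ≈ₚ q does not).
  infix 4 _≋_
  record _≋_ (p q : Pol) : Set ℓ where
    constructor coeffwise
    field at : p ≈ₚ q
  open _≋_ public

  ≋-setoid : Setoid c ℓ
  ≋-setoid = record
    { Carrier       = Pol
    ; _≈_           = _≋_
    ; isEquivalence = record
      { refl  = coeffwise λ _ → refl
      ; sym   = λ e → coeffwise λ i → sym (at e i)
      ; trans = λ e f → coeffwise λ i → trans (at e i) (at f i)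
      }
    }

  open Setoid ≋-setoid public using ()
    renaming (refl to ≋-refl; sym to ≋-sym; trans to ≋-trans)
  module ≋-Reasoning = SetoidReasoning ≋-setoid

  ∷-cong : ∀ {a b p q} → a ≈ b → p ≋ q → (a ∷ p) ≋ (b ∷ q)
  ∷-cong a≈b p≋q = coeffwise λ { zero → a≈b ; (suc i) → at p≋q i }

  coeff-+ : ∀ p q i → coeff (p +ₚ q) i ≈ coeff p i + coeff q i
  coeff-+ []      q       i       = sym (+-identityˡ _)
  coeff-+ (a ∷ p) []      i       = sym (+-identityʳ _)
  coeff-+ (a ∷ p) (b ∷ q) zero    = refl
  coeff-+ (a ∷ p) (b ∷ q) (suc i) = coeff-+ p q i

  coeff-· : ∀ a p i → coeff (a ·ₚ p) i ≈ a * coeff p i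
  coeff-· a []      i       = sym (zeroʳ a)
  coeff-· a (b ∷ p) zero    = refl
  coeff-· a (b ∷ p) (suc i) = coeff-· a p i

  +ₚ-cong : ∀ {p p′ q q′} → p ≋ p′ → q ≋ q′ → p +ₚ q ≋ p′ +ₚ q′
  +ₚ-cong {p} {p′} {q} {q′} e f = coeffwise λ i →
    trans (coeff-+ p q i) (trans (+-cong (at e i) (at f i)) (sym (coeff-+ p′ q′ i)))

  +ₚ-assoc : ∀ p q r → (p +ₚ q) +ₚ r ≋ p +ₚ (q +ₚ r)
  +ₚ-assoc p q r = coeffwise λ i →
    trans (trans (coeff-+ (p +ₚ q) r i) (+-cong (coeff-+ p q i) refl))
      (trans (+-assoc _ _ _) (sym (trans (coeff-+ p (q +ₚ r) i) (+-cong refl (coeff-+ q r i)))))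

  +ₚ-comm : ∀ p q → p +ₚ q ≋ q +ₚ p
  +ₚ-comm p q = coeffwise λ i → trans (coeff-+ p q i) (trans (+-comm _ _) (sym (coeff-+ q p i)))

  +ₚ-identityʳ : ∀ p → p +ₚ [] ≋ p
  +ₚ-identityʳ p = coeffwise λ i → trans (coeff-+ p [] i) (+-identityʳ _)

  -- Hence (Pol, +ₚ, []) is a commutative monoid up to ≋, which gives us the
  -- library's rearrangement lemmas for sums of polynomials.
  +ₚ-commutativeMonoid : CommutativeMonoid c ℓ
  +ₚ-commutativeMonoid = record
    { Carrier = Pol ; _≈_ = _≋_ ; _∙_ = _+ₚ_ ; ε = []
    ; isCommutativeMonoid = record
      { isMonoid = record
        { isSemigroup = record
          { isMagma = record { isEquivalence = Setoid.isEquivalence ≋-setoid ; ∙-cong = +ₚ-cong }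
          ; assoc   = +ₚ-assoc
          }
        ; identity = (λ p → ≋-refl) , +ₚ-identityʳ
        }
      ; comm = +ₚ-comm
      }
    }

  open CommutativeSemigroupProperties (CommutativeMonoid.commutativeSemigroup +ₚ-commutativeMonoid)
    using () renaming (interchange to +ₚ-interchange; x∙yz≈y∙xz to +ₚ-leftComm; xy∙z≈xz∙y to +ₚ-rightComm)

  ·ₚ-cong : ∀ {a b p q} → a ≈ b → p ≋ q → a ·ₚ p ≋ b ·ₚ q
  ·ₚ-cong {a} {b} {p} {q} a≈b p≋q = coeffwise λ i →
    trans (coeff-· a p i) (trans (*-cong a≈b (at p≋q i)) (sym (coeff-· b q i)))

  ·ₚ-assoc : ∀ a b p → a ·ₚ (b ·ₚ p) ≋ (a * b) ·ₚ p
  ·ₚ-assoc a b p = coeffwise λ i →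
    trans (coeff-· a (b ·ₚ p) i) (trans (*-cong refl (coeff-· b p i))
      (trans (sym (*-assoc a b _)) (sym (coeff-· (a * b) p i))))

  ·ₚ-identity : ∀ p → 1# ·ₚ p ≋ p
  ·ₚ-identity p = coeffwise λ i → trans (coeff-· 1# p i) (*-identityˡ _)

  ·ₚ-zero : ∀ {a} p → a ≈ 0# → a ·ₚ p ≋ []
  ·ₚ-zero {a} p a≈0 = coeffwise λ i → trans (coeff-· a p i) (trans (*-cong a≈0 refl) (zeroˡ _))

  ·ₚ-distribˡ : ∀ a p q → a ·ₚ (p +ₚ q) ≋ a ·ₚ p +ₚ a ·ₚ q
  ·ₚ-distribˡ a p q = coeffwise λ i →
    trans (coeff-· a (p +ₚ q) i) (trans (*-cong refl (coeff-+ p q i))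
      (trans (distribˡ a _ _) (sym (trans (coeff-+ (a ·ₚ p) (a ·ₚ q) i) (+-cong (coeff-· a p i) (coeff-· a q i))))))

  ·ₚ-distribʳ : ∀ a b p → (a + b) ·ₚ p ≋ a ·ₚ p +ₚ b ·ₚ p
  ·ₚ-distribʳ a b p = coeffwise λ i →
    trans (coeff-· (a + b) p i) (trans (distribʳ _ a b)
      (sym (trans (coeff-+ (a ·ₚ p) (b ·ₚ p) i) (+-cong (coeff-· a p i) (coeff-· b p i)))))

  ·ₚ-comm : ∀ a b p → a ·ₚ (b ·ₚ p) ≋ b ·ₚ (a ·ₚ p)
  ·ₚ-comm a b p = ≋-trans (·ₚ-assoc a b p) (≋-trans (·ₚ-cong (*-comm a b) ≋-refl) (≋-sym (·ₚ-assoc b a p)))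

  shift-+ : ∀ p q → (0# ∷ (p +ₚ q)) ≋ (0# ∷ p) +ₚ (0# ∷ q)
  shift-+ p q = ∷-cong (sym (+-identityʳ 0#)) ≋-refl

  shift-· : ∀ a p → (0# ∷ (a ·ₚ p)) ≋ a ·ₚ (0# ∷ p)
  shift-· a p = ∷-cong (sym (zeroʳ a)) ≋-refl

  ∷-[] : ∀ {a p} → a ≈ 0# → p ≋ [] → (a ∷ p) ≋ []
  ∷-[] a≈0 p≋[] = coeffwise λ { zero → a≈0 ; (suc i) → at p≋[] i }

  -- By definition (a ∷ p) *ₚ q = a ·ₚ q +ₚ x·(p *ₚ q), so the
  -- basic laws go by induction on the left factor; once commutativity is known,
  -- the laws for the other factor follow from them.
  *ₚ-congʳ : ∀ p {q q′} → q ≋ q′ → p *ₚ q ≋ p *ₚ q′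
  *ₚ-congʳ []      q≋q′ = ≋-refl
  *ₚ-congʳ (a ∷ p) q≋q′ = +ₚ-cong (·ₚ-cong refl q≋q′) (∷-cong refl (*ₚ-congʳ p q≋q′))

  *ₚ-zeroʳ : ∀ p → p *ₚ [] ≋ []
  *ₚ-zeroʳ []      = ≋-refl
  *ₚ-zeroʳ (a ∷ p) = ∷-[] refl (*ₚ-zeroʳ p)

  *ₚ-shiftˡ : ∀ p q → (0# ∷ p) *ₚ q ≋ (0# ∷ (p *ₚ q))
  *ₚ-shiftˡ p q = +ₚ-cong (·ₚ-zero q refl) ≋-refl

  *ₚ-·ʳ : ∀ a p q → p *ₚ (a ·ₚ q) ≋ a ·ₚ (p *ₚ q)
  *ₚ-·ʳ a []      q = ≋-refl
  *ₚ-·ʳ a (b ∷ p) q = begin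
    b ·ₚ (a ·ₚ q) +ₚ (0# ∷ (p *ₚ (a ·ₚ q)))  ≈⟨ +ₚ-cong (·ₚ-comm b a q) (∷-cong refl (*ₚ-·ʳ a p q)) ⟩
    a ·ₚ (b ·ₚ q) +ₚ (0# ∷ (a ·ₚ (p *ₚ q)))  ≈⟨ +ₚ-cong ≋-refl (shift-· a (p *ₚ q)) ⟩
    a ·ₚ (b ·ₚ q) +ₚ a ·ₚ (0# ∷ (p *ₚ q))    ≈⟨ ≋-sym (·ₚ-distribˡ a (b ·ₚ q) (0# ∷ (p *ₚ q))) ⟩
    a ·ₚ ((b ∷ p) *ₚ q)                      ∎
    where open ≋-Reasoning

  *ₚ-distribˡ : ∀ p q r → p *ₚ (q +ₚ r) ≋ p *ₚ q +ₚ p *ₚ r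
  *ₚ-distribˡ []      q r = ≋-refl
  *ₚ-distribˡ (a ∷ p) q r = begin
    a ·ₚ (q +ₚ r) +ₚ (0# ∷ (p *ₚ (q +ₚ r)))                   ≈⟨ +ₚ-cong (·ₚ-distribˡ a q r) (∷-cong refl (*ₚ-distribˡ p q r)) ⟩
    (a ·ₚ q +ₚ a ·ₚ r) +ₚ (0# ∷ (p *ₚ q +ₚ p *ₚ r))           ≈⟨ +ₚ-cong ≋-refl (shift-+ (p *ₚ q) (p *ₚ r)) ⟩
    (a ·ₚ q +ₚ a ·ₚ r) +ₚ ((0# ∷ (p *ₚ q)) +ₚ (0# ∷ (p *ₚ r))) ≈⟨ +ₚ-interchange (a ·ₚ q) (a ·ₚ r) (0# ∷ (p *ₚ q)) (0# ∷ (p *ₚ r)) ⟩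
    (a ∷ p) *ₚ q +ₚ (a ∷ p) *ₚ r                               ∎
    where open ≋-Reasoning

  *ₚ-∷ʳ : ∀ q a p → q *ₚ (a ∷ p) ≋ a ·ₚ q +ₚ (0# ∷ (q *ₚ p))
  *ₚ-∷ʳ []      a p = ≋-sym (∷-[] refl ≋-refl)
  *ₚ-∷ʳ (b ∷ q) a p = ∷-cong (+-cong (*-comm b a) refl) (begin
    b ·ₚ p +ₚ q *ₚ (a ∷ p)                  ≈⟨ +ₚ-cong ≋-refl (*ₚ-∷ʳ q a p) ⟩
    b ·ₚ p +ₚ (a ·ₚ q +ₚ (0# ∷ (q *ₚ p)))   ≈⟨ +ₚ-leftComm (b ·ₚ p) (a ·ₚ q) (0# ∷ (q *ₚ p)) ⟩
    a ·ₚ q +ₚ (b ·ₚ p +ₚ (0# ∷ (q *ₚ p)))   ∎)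
    where open ≋-Reasoning

  *ₚ-comm : ∀ p q → p *ₚ q ≋ q *ₚ p
  *ₚ-comm []      q = ≋-sym (*ₚ-zeroʳ q)
  *ₚ-comm (a ∷ p) q = ≋-trans (+ₚ-cong ≋-refl (∷-cong refl (*ₚ-comm p q))) (≋-sym (*ₚ-∷ʳ q a p))

  *ₚ-congˡ : ∀ {p p′} q → p ≋ p′ → p *ₚ q ≋ p′ *ₚ q
  *ₚ-congˡ {p} {p′} q p≋p′ = ≋-trans (*ₚ-comm p q) (≋-trans (*ₚ-congʳ q p≋p′) (*ₚ-comm q p′))

  *ₚ-distribʳ : ∀ p q r → (p +ₚ q) *ₚ r ≋ p *ₚ r +ₚ q *ₚ r
  *ₚ-distribʳ p q r = ≋-trans (*ₚ-comm (p +ₚ q) r)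
    (≋-trans (*ₚ-distribˡ r p q) (+ₚ-cong (*ₚ-comm r p) (*ₚ-comm r q)))

  *ₚ-·ˡ : ∀ a p q → (a ·ₚ p) *ₚ q ≋ a ·ₚ (p *ₚ q)
  *ₚ-·ˡ a p q = ≋-trans (*ₚ-comm (a ·ₚ p) q) (≋-trans (*ₚ-·ʳ a q p) (·ₚ-cong refl (*ₚ-comm q p)))

  *ₚ-assoc : ∀ p q r → (p *ₚ q) *ₚ r ≋ p *ₚ (q *ₚ r)
  *ₚ-assoc []      q r = ≋-refl
  *ₚ-assoc (a ∷ p) q r = begin
    (a ·ₚ q +ₚ (0# ∷ (p *ₚ q))) *ₚ r            ≈⟨ *ₚ-distribʳ (a ·ₚ q) _ r ⟩
    (a ·ₚ q) *ₚ r +ₚ (0# ∷ (p *ₚ q)) *ₚ r       ≈⟨ +ₚ-cong (*ₚ-·ˡ a q r) (*ₚ-shiftˡ (p *ₚ q) r) ⟩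
    a ·ₚ (q *ₚ r) +ₚ (0# ∷ ((p *ₚ q) *ₚ r))     ≈⟨ +ₚ-cong ≋-refl (∷-cong refl (*ₚ-assoc p q r)) ⟩
    (a ∷ p) *ₚ (q *ₚ r)                          ∎
    where open ≋-Reasoning

  *ₚ-leftComm : ∀ p q r → p *ₚ (q *ₚ r) ≋ q *ₚ (p *ₚ r)
  *ₚ-leftComm p q r = ≋-trans (≋-sym (*ₚ-assoc p q r))
    (≋-trans (*ₚ-congˡ r (*ₚ-comm p q)) (*ₚ-assoc q p r))

  *ₚ-identityˡ : ∀ p → oneₚ *ₚ p ≋ p
  *ₚ-identityˡ p = ≋-trans (+ₚ-cong (·ₚ-identity p) (∷-[] refl ≋-refl)) (+ₚ-identityʳ p)

  xPlus-* : ∀ a p → xPlus a *ₚ p ≋ a ·ₚ p +ₚ (0# ∷ p)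
  xPlus-* a p = +ₚ-cong ≋-refl (∷-cong refl (*ₚ-identityˡ p))

  ^ₚ-+ : ∀ q m k X → q ^ₚ m *ₚ (q ^ₚ k *ₚ X) ≋ q ^ₚ (m ℕ.+ k) *ₚ X
  ^ₚ-+ q zero    k X = *ₚ-identityˡ _
  ^ₚ-+ q (suc m) k X = ≋-trans (*ₚ-assoc q (q ^ₚ m) _)
    (≋-trans (*ₚ-congʳ q (^ₚ-+ q m k X)) (≋-sym (*ₚ-assoc q (q ^ₚ (m ℕ.+ k)) X)))

  iterate : (Pol → Pol → Pol) → Pol → ℕ → (ℕ → Pol) → Pol
  iterate _⊕_ e zero    f = e
  iterate _⊕_ e (suc n) f = f 0 ⊕ iterate _⊕_ e n (f ∘ suc)

  foldr-applyUpTo : ∀ _⊕_ e n h (f : ℕ → Pol) →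
    foldr (λ i acc → f i ⊕ acc) e (applyUpTo h n) ≡ iterate _⊕_ e n (f ∘ h)
  foldr-applyUpTo _⊕_ e zero    h f = ≡.refl
  foldr-applyUpTo _⊕_ e (suc n) h f = ≡.cong (f (h 0) ⊕_) (foldr-applyUpTo _⊕_ e n (h ∘ suc) f)

  sumₚ : ℕ → (ℕ → Pol) → Pol
  sumₚ = iterate _+ₚ_ []

  prodₚ : ℕ → (ℕ → Pol) → Pol
  prodₚ = iterate _*ₚ_ oneₚ

  Σₚ<-sumₚ : ∀ n f → Σₚ< n f ≡ sumₚ n f
  Σₚ<-sumₚ n f = foldr-applyUpTo _+ₚ_ [] n (λ i → i) f

  Πₚ<-prodₚ : ∀ n f → Πₚ< n f ≡ prodₚ n f
  Πₚ<-prodₚ n f = foldr-applyUpTo _*ₚ_ oneₚ n (λ i → i) f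

  sumₚ-cong : ∀ n {f g} → (∀ p → p < n → f p ≋ g p) → sumₚ n f ≋ sumₚ n g
  sumₚ-cong zero    f≋g = ≋-refl
  sumₚ-cong (suc n) f≋g = +ₚ-cong (f≋g 0 (s≤s z≤n)) (sumₚ-cong n λ p p<n → f≋g (suc p) (s≤s p<n))

  sumₚ-snoc : ∀ n f → sumₚ (suc n) f ≋ sumₚ n f +ₚ f n
  sumₚ-snoc zero    f = +ₚ-identityʳ (f 0)
  sumₚ-snoc (suc n) f = ≋-trans (+ₚ-cong (≋-refl {f 0}) (sumₚ-snoc n (f ∘ suc)))
    (≋-sym (+ₚ-assoc (f 0) (sumₚ n (f ∘ suc)) (f (suc n))))

  prodₚ-snoc : ∀ n f → prodₚ (suc n) f ≋ prodₚ n f *ₚ f n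
  prodₚ-snoc zero    f = *ₚ-comm (f 0) oneₚ
  prodₚ-snoc (suc n) f = ≋-trans (*ₚ-congʳ (f 0) (prodₚ-snoc n (f ∘ suc)))
    (≋-sym (*ₚ-assoc (f 0) (prodₚ n (f ∘ suc)) (f (suc n))))

  sumₚ-vanishing : ∀ n f → (∀ p → f p ≋ []) → sumₚ n f ≋ []
  sumₚ-vanishing zero    f vanish = ≋-refl
  sumₚ-vanishing (suc n) f vanish = +ₚ-cong (vanish 0) (sumₚ-vanishing n (f ∘ suc) (vanish ∘ suc))

  sumₚ-truncate : ∀ {k n} f → k ≤ n → (∀ p → k ≤ p → f p ≋ []) → sumₚ n f ≋ sumₚ k f
  sumₚ-truncate {zero}  {n}     f k≤n vanish = sumₚ-vanishing n f λ p → vanish p z≤n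
  sumₚ-truncate {suc k} {suc n} f (s≤s k≤n) vanish =
    +ₚ-cong ≋-refl (sumₚ-truncate (f ∘ suc) k≤n λ p k≤p → vanish (suc p) (s≤s k≤p))

  sumₚ-· : ∀ n a f → a ·ₚ sumₚ n f ≋ sumₚ n (λ p → a ·ₚ f p)
  sumₚ-· zero    a f = ≋-refl
  sumₚ-· (suc n) a f = ≋-trans (·ₚ-distribˡ a (f 0) (sumₚ n (f ∘ suc))) (+ₚ-cong ≋-refl (sumₚ-· n a (f ∘ suc)))

  sumₚ-* : ∀ n q f → q *ₚ sumₚ n f ≋ sumₚ n (λ p → q *ₚ f p)
  sumₚ-* zero    q f = *ₚ-zeroʳ q
  sumₚ-* (suc n) q f = ≋-trans (*ₚ-distribˡ q (f 0) (sumₚ n (f ∘ suc))) (+ₚ-cong ≋-refl (sumₚ-* n q (f ∘ suc)))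

  Πₚ<-snoc : ∀ n f → Πₚ< (suc n) f ≋ Πₚ< n f *ₚ f n
  Πₚ<-snoc n f = begin
    Πₚ< (suc n) f       ≡⟨ Πₚ<-prodₚ (suc n) f ⟩
    prodₚ (suc n) f     ≈⟨ prodₚ-snoc n f ⟩
    prodₚ n f *ₚ f n    ≡⟨ ≡.cong (_*ₚ f n) (≡.sym (Πₚ<-prodₚ n f)) ⟩
    Πₚ< n f *ₚ f n      ∎
    where open ≋-Reasoning

  ι-+ : ∀ a b → ι (a ℕ.+ b) ≈ ι a + ι b
  ι-+ zero    b = sym (+-identityˡ _)
  ι-+ (suc a) b = trans (+-cong refl (ι-+ a b)) (sym (+-assoc 1# _ _))

  ι-* : ∀ a b → ι (a ℕ.* b) ≈ ι a * ι b
  ι-* zero    b = sym (zeroˡ _)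
  ι-* (suc a) b = trans (ι-+ b (a ℕ.* b))
    (trans (+-cong (sym (*-identityˡ _)) (ι-* a b)) (sym (distribʳ _ 1# (ι a))))

  Reciprocals : Set ℓ
  Reciprocals = ∀ k → ι (suc k) * recip k ≈ 1#

  ι!-invfact : Reciprocals → ∀ N → ι (N !) * invfact N ≈ 1#
  ι!-invfact inverse zero    = trans (*-identityʳ _) (+-identityʳ 1#)
  ι!-invfact inverse (suc N) = begin
    ι (suc N ℕ.* N !) * (recip N * invfact N)       ≈⟨ *-cong (ι-* (suc N) (N !)) refl ⟩
    (ι (suc N) * ι (N !)) * (recip N * invfact N)   ≈⟨ swap (ι (suc N)) (ι (N !)) (recip N) (invfact N) ⟩
    (ι (suc N) * recip N) * (ι (N !) * invfact N)   ≈⟨ *-cong (inverse N) (ι!-invfact inverse N) ⟩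
    1# * 1#                                         ≈⟨ *-identityʳ 1# ⟩
    1#                                              ∎
    where
    open ≈-Reasoning
    swap : ∀ a b x y → (a * b) * (x * y) ≈ (a * x) * (b * y)
    swap = solve 4 (λ a b x y → (a :* b) :* (x :* y) := (a :* x) :* (b :* y)) refl

  UTerm : ℕ → Pol → ℕ → Pol
  UTerm M s p = coeff s p ·ₚ (invfact M ·ₚ (oneMinusX ^ₚ (M ∸ 1 ∸ p) *ₚ Ã (suc p)))

  U-sum : ∀ M s → U M s ≡ sumₚ M (UTerm M s)
  U-sum M s = Σₚ<-sumₚ M (UTerm M s)

  exponent-split : ∀ m {N p} → p < N → m ℕ.+ N ∸ 1 ∸ p ≡ m ℕ.+ (N ∸ 1 ∸ p)
  exponent-split m {N} {p} p<N = begin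
    m ℕ.+ N ∸ 1 ∸ p       ≡⟨ ∸-+-assoc (m ℕ.+ N) 1 p ⟩
    m ℕ.+ N ∸ suc p       ≡⟨ +-∸-assoc m p<N ⟩
    m ℕ.+ (N ∸ suc p)     ≡⟨ ≡.cong (m ℕ.+_) (≡.sym (∸-+-assoc N 1 p)) ⟩
    m ℕ.+ (N ∸ 1 ∸ p)     ∎
    where open ≡.≡-Reasoning

  UTerm-factor : Reciprocals → ∀ m N s p → p < N →
    UTerm (m ℕ.+ N) s p ≋ oneMinusX ^ₚ m *ₚ ((ι (N !) * invfact (m ℕ.+ N)) ·ₚ UTerm N s p)
  UTerm-factor inverse m N s p p<N = begin
    UTerm (m ℕ.+ N) s p                  ≡⟨ ≡.cong (λ e → sp ·ₚ (v ·ₚ (Q ^ₚ e *ₚ Ã (suc p)))) (exponent-split m p<N) ⟩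
    sp ·ₚ (v ·ₚ X)                       ≈⟨ ·ₚ-assoc sp v X ⟩
    (sp * v) ·ₚ X                        ≈⟨ ·ₚ-cong constants ≋-refl ⟩
    (K * (sp * w)) ·ₚ X                  ≈⟨ ≋-sym (≋-trans (·ₚ-cong refl (·ₚ-assoc sp w X)) (·ₚ-assoc K (sp * w) X)) ⟩
    K ·ₚ (sp ·ₚ (w ·ₚ X))                ≈⟨ ·ₚ-cong refl (·ₚ-cong refl (·ₚ-cong refl (≋-sym (^ₚ-+ Q m _ (Ã (suc p)))))) ⟩
    K ·ₚ (sp ·ₚ (w ·ₚ (Q ^ₚ m *ₚ Y)))    ≈⟨ ·ₚ-cong refl (·ₚ-cong refl (≋-sym (*ₚ-·ʳ w (Q ^ₚ m) Y))) ⟩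
    K ·ₚ (sp ·ₚ (Q ^ₚ m *ₚ (w ·ₚ Y)))    ≈⟨ ·ₚ-cong refl (≋-sym (*ₚ-·ʳ sp (Q ^ₚ m) (w ·ₚ Y))) ⟩
    K ·ₚ (Q ^ₚ m *ₚ UTerm N s p)         ≈⟨ ≋-sym (*ₚ-·ʳ K (Q ^ₚ m) (UTerm N s p)) ⟩
    Q ^ₚ m *ₚ (K ·ₚ UTerm N s p)         ∎
    where
    open ≋-Reasoning
    Q = oneMinusX
    sp = coeff s p
    v = invfact (m ℕ.+ N)
    w = invfact N
    K = ι (N !) * v
    Y = Q ^ₚ (N ∸ 1 ∸ p) *ₚ Ã (suc p)
    X = Q ^ₚ (m ℕ.+ (N ∸ 1 ∸ p)) *ₚ Ã (suc p)
    constants : sp * v ≈ K * (sp * w)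
    constants = ≈-Reasoning.begin
      sp * v                      ≈-Reasoning.≈⟨ sym (*-identityʳ _) ⟩
      (sp * v) * 1#               ≈-Reasoning.≈⟨ *-cong refl (sym (ι!-invfact inverse N)) ⟩
      (sp * v) * (ι (N !) * w)    ≈-Reasoning.≈⟨ regroup sp v (ι (N !)) w ⟩
      K * (sp * w)                ≈-Reasoning.∎
      where
      regroup : ∀ a b x y → (a * b) * (x * y) ≈ (x * b) * (a * y)
      regroup = solve 4 (λ a b x y → (a :* b) :* (x :* y) := (x :* b) :* (a :* y)) refl

  -- First half of the theorem: Ũ_{m+N} s = (1-x)^m (N!/(m+N)!) Ũ_N s
  -- for deg s < N.  Only the summands p < N survive, and each factors.
  U-factor : Reciprocals → ∀ m N s → DegLt s N →
    U (m ℕ.+ N) s ≋ oneMinusX ^ₚ m *ₚ ((ι (N !) * invfact (m ℕ.+ N)) ·ₚ U N s)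
  U-factor inverse m N s deg = begin
    U (m ℕ.+ N) s                                   ≡⟨ U-sum (m ℕ.+ N) s ⟩
    sumₚ (m ℕ.+ N) (UTerm (m ℕ.+ N) s)              ≈⟨ sumₚ-truncate (UTerm (m ℕ.+ N) s) (m≤n+m N m) high-terms-vanish ⟩
    sumₚ N (UTerm (m ℕ.+ N) s)                      ≈⟨ sumₚ-cong N (UTerm-factor inverse m N s) ⟩
    sumₚ N (λ p → Q ^ₚ m *ₚ (K ·ₚ UTerm N s p))     ≈⟨ ≋-sym (sumₚ-* N (Q ^ₚ m) (λ p → K ·ₚ UTerm N s p)) ⟩
    Q ^ₚ m *ₚ sumₚ N (λ p → K ·ₚ UTerm N s p)       ≈⟨ *ₚ-congʳ (Q ^ₚ m) (≋-sym (sumₚ-· N K (UTerm N s))) ⟩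
    Q ^ₚ m *ₚ (K ·ₚ sumₚ N (UTerm N s))             ≡⟨ ≡.cong (λ u → Q ^ₚ m *ₚ (K ·ₚ u)) (≡.sym (U-sum N s)) ⟩
    Q ^ₚ m *ₚ (K ·ₚ U N s)                          ∎
    where
    open ≋-Reasoning
    Q = oneMinusX
    K = ι (N !) * invfact (m ℕ.+ N)
    high-terms-vanish : ∀ p → N ≤ p → UTerm (m ℕ.+ N) s p ≋ []
    high-terms-vanish p N≤p = ·ₚ-zero _ (deg p N≤p)

  -- Backward differences (with d_{-1} = 0).
  Δ : (ℕ → Carrier) → ℕ → Carrier
  Δ d zero    = d 0
  Δ d (suc p) = d (suc p) + - d p

  oneMinusX-* : ∀ d → oneMinusX *ₚ d ≋ d +ₚ (0# ∷ ((- 1#) ·ₚ d))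
  oneMinusX-* d = +ₚ-cong (·ₚ-identity d)
    (∷-cong refl (≋-trans (+ₚ-cong ≋-refl (∷-[] refl ≋-refl)) (+ₚ-identityʳ ((- 1#) ·ₚ d))))

  coeff-oneMinusX* : ∀ d p → coeff (oneMinusX *ₚ d) p ≈ Δ (coeff d) p
  coeff-oneMinusX* d zero    = trans (at (oneMinusX-* d) 0) (trans (coeff-+ d _ 0) (+-identityʳ _))
  coeff-oneMinusX* d (suc p) = trans (at (oneMinusX-* d) (suc p))
    (trans (coeff-+ d _ (suc p)) (+-cong refl (trans (coeff-· (- 1#) d p) (-1*x≈-x _))))

  DegLt-cong : ∀ {p q k} → p ≋ q → DegLt p k → DegLt q k
  DegLt-cong p≋q deg i k≤i = trans (sym (at p≋q i)) (deg i k≤i)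

  DegLt-oneMinusX* : ∀ d N → DegLt d N → DegLt (oneMinusX *ₚ d) (suc N)
  DegLt-oneMinusX* d N deg (suc i) (s≤s N≤i) = trans (coeff-oneMinusX* d (suc i))
    (trans (+-cong (deg (suc i) (m≤n⇒m≤1+n N≤i)) (-‿cong (deg i N≤i))) (-‿inverseʳ 0#))

  DegLt-oneMinusX^* : ∀ m N c → DegLt c N → DegLt (oneMinusX ^ₚ m *ₚ c) (m ℕ.+ N)
  DegLt-oneMinusX^* zero    N c deg = DegLt-cong (≋-sym (*ₚ-identityˡ c)) deg
  DegLt-oneMinusX^* (suc m) N c deg = DegLt-cong (≋-sym (*ₚ-assoc oneMinusX (oneMinusX ^ₚ m) c))
    (DegLt-oneMinusX* (oneMinusX ^ₚ m *ₚ c) (m ℕ.+ N) (DegLt-oneMinusX^* m N c deg))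

  -- One step of summation by parts: x (g + h) + (y - x) g = x h + y g,
  -- checked coefficientwise (next to an arbitrary further summand S).
  difference-step : ∀ S x y g h →
    (S +ₚ x ·ₚ (g +ₚ h)) +ₚ (y + - x) ·ₚ g ≋ (S +ₚ x ·ₚ h) +ₚ y ·ₚ g
  difference-step S x y g h = coeffwise at-i
    where
    regroup : ∀ s x n y g h → (s + x * (g + h)) + (y + n) * g ≈ ((s + x * h) + y * g) + (x + n) * g
    regroup = solve 6 (λ s x n y g h →
      (s :+ x :* (g :+ h)) :+ (y :+ n) :* g := ((s :+ x :* h) :+ y :* g) :+ (x :+ n) :* g) refl
    at-i : ∀ i → coeff ((S +ₚ x ·ₚ (g +ₚ h)) +ₚ (y + - x) ·ₚ g) i ≈ coeff ((S +ₚ x ·ₚ h) +ₚ y ·ₚ g) i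
    at-i i = begin
      coeff ((S +ₚ x ·ₚ (g +ₚ h)) +ₚ (y + - x) ·ₚ g) i
        ≈⟨ trans (coeff-+ (S +ₚ x ·ₚ (g +ₚ h)) ((y + - x) ·ₚ g) i) (+-cong (trans (coeff-+ S (x ·ₚ (g +ₚ h)) i)
             (+-cong refl (trans (coeff-· x (g +ₚ h) i) (*-cong refl (coeff-+ g h i))))) (coeff-· (y + - x) g i)) ⟩
      (sᵢ + x * (gᵢ + hᵢ)) + (y + - x) * gᵢ
        ≈⟨ regroup sᵢ x (- x) y gᵢ hᵢ ⟩
      ((sᵢ + x * hᵢ) + y * gᵢ) + (x + - x) * gᵢ
        ≈⟨ +-cong refl (trans (*-cong (-‿inverseʳ x) refl) (zeroˡ gᵢ)) ⟩
      ((sᵢ + x * hᵢ) + y * gᵢ) + 0#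
        ≈⟨ +-identityʳ _ ⟩
      (sᵢ + x * hᵢ) + y * gᵢ
        ≈⟨ sym (trans (coeff-+ (S +ₚ x ·ₚ h) (y ·ₚ g) i) (+-cong (trans (coeff-+ S (x ·ₚ h) i) (+-cong refl (coeff-· x h i))) (coeff-· y g i))) ⟩
      coeff ((S +ₚ x ·ₚ h) +ₚ y ·ₚ g) i ∎
      where
      open ≈-Reasoning
      sᵢ = coeff S i
      gᵢ = coeff g i
      hᵢ = coeff h i

  summation-by-parts : ∀ N (d : ℕ → Carrier) (G H : ℕ → Pol) → (∀ p → p < N → G p ≋ G (suc p) +ₚ H p) →
    sumₚ (suc N) (λ p → Δ d p ·ₚ G p) ≋ sumₚ N (λ p → d p ·ₚ H p) +ₚ d N ·ₚ G N
  summation-by-parts zero    d G H rec = +ₚ-identityʳ (d 0 ·ₚ G 0)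
  summation-by-parts (suc N) d G H rec = begin
    sumₚ (suc (suc N)) ΔdG                           ≈⟨ sumₚ-snoc (suc N) ΔdG ⟩
    sumₚ (suc N) ΔdG +ₚ T                            ≈⟨ +ₚ-cong (summation-by-parts N d G H rec′) (≋-refl {T}) ⟩
    (S +ₚ d N ·ₚ G N) +ₚ T                           ≈⟨ +ₚ-cong (+ₚ-cong (≋-refl {S}) (·ₚ-cong refl (rec N ≤-refl))) (≋-refl {T}) ⟩
    (S +ₚ d N ·ₚ (G (suc N) +ₚ H N)) +ₚ T            ≈⟨ difference-step S (d N) (d (suc N)) (G (suc N)) (H N) ⟩
    (S +ₚ d N ·ₚ H N) +ₚ d (suc N) ·ₚ G (suc N)      ≈⟨ +ₚ-cong (≋-sym (sumₚ-snoc N dH)) (≋-refl {d (suc N) ·ₚ G (suc N)}) ⟩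
    sumₚ (suc N) dH +ₚ d (suc N) ·ₚ G (suc N)        ∎
    where
    open ≋-Reasoning
    ΔdG dH : ℕ → Pol
    ΔdG p = Δ d p ·ₚ G p
    dH p = d p ·ₚ H p
    S = sumₚ N dH
    T = Δ d (suc N) ·ₚ G (suc N)
    rec′ : ∀ p → p < N → G p ≋ G (suc p) +ₚ H p
    rec′ p p<N = rec p (m≤n⇒m≤1+n p<N)

  basis : ℕ → ℕ → Pol
  basis p q = falling p *ₚ rising q

  xPlus-shift : ∀ {a b c} Y → b + c ≈ a → xPlus a *ₚ Y ≋ xPlus b *ₚ Y +ₚ c ·ₚ Y
  xPlus-shift {a} {b} {c} Y b+c≈a = begin
    xPlus a *ₚ Y                     ≈⟨ xPlus-* a Y ⟩
    a ·ₚ Y +ₚ (0# ∷ Y)               ≈⟨ +ₚ-cong (≋-trans (·ₚ-cong (sym b+c≈a) ≋-refl) (·ₚ-distribʳ b c Y)) ≋-refl ⟩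
    (b ·ₚ Y +ₚ c ·ₚ Y) +ₚ (0# ∷ Y)   ≈⟨ +ₚ-rightComm (b ·ₚ Y) (c ·ₚ Y) (0# ∷ Y) ⟩
    (b ·ₚ Y +ₚ (0# ∷ Y)) +ₚ c ·ₚ Y   ≈⟨ +ₚ-cong (≋-sym (xPlus-* b Y)) ≋-refl ⟩
    xPlus b *ₚ Y +ₚ c ·ₚ Y           ∎
    where open ≋-Reasoning

  -- Moving one linear factor from the rising to the falling part:
  -- (x + q + 1) - (x - p - 1) = p + q + 2.
  basis-recurrence : ∀ p q → basis p (suc q) ≋ basis (suc p) q +ₚ ι (suc p ℕ.+ suc q) ·ₚ basis p q
  basis-recurrence p q = begin
    falling p *ₚ rising (suc q)                   ≈⟨ *ₚ-congʳ (falling p) (Πₚ<-snoc q (λ j → xPlus (ι (suc j)))) ⟩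
    falling p *ₚ (rising q *ₚ xa)                 ≈⟨ *ₚ-congʳ (falling p) (*ₚ-comm (rising q) xa) ⟩
    falling p *ₚ (xa *ₚ rising q)                 ≈⟨ *ₚ-leftComm (falling p) xa (rising q) ⟩
    xa *ₚ basis p q                               ≈⟨ xPlus-shift (basis p q) constants ⟩
    xb *ₚ basis p q +ₚ r ·ₚ basis p q             ≈⟨ +ₚ-cong (≋-sym (*ₚ-assoc xb (falling p) (rising q))) ≋-refl ⟩
    (xb *ₚ falling p) *ₚ rising q +ₚ r ·ₚ basis p q
      ≈⟨ +ₚ-cong (*ₚ-congˡ (rising q) (≋-trans (*ₚ-comm xb (falling p))
                    (≋-sym (Πₚ<-snoc p (λ j → xPlus (- ι (suc j))))))) ≋-refl ⟩
    basis (suc p) q +ₚ r ·ₚ basis p q             ∎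
    where
    open ≋-Reasoning
    xa = xPlus (ι (suc q))
    xb = xPlus (- ι (suc p))
    r = ι (suc p ℕ.+ suc q)
    constants : - ι (suc p) + r ≈ ι (suc q)
    constants = trans (+-cong refl (ι-+ (suc p) (suc q)))
      (trans (sym (+-assoc _ _ _)) (trans (+-cong (-‿inverseˡ _) refl) (+-identityˡ _)))

  Uinv-sum : ∀ M s → Uinv M s ≡ sumₚ M (λ p → coeff s p ·ₚ basis p (M ∸ p ∸ 1))
  Uinv-sum M s = Σₚ<-sumₚ M (λ p → coeff s p ·ₚ basis p (M ∸ p ∸ 1))

  Uinv-cong : ∀ M {s t} → s ≋ t → Uinv M s ≋ Uinv M t
  Uinv-cong M {s} {t} s≋t = begin
    Uinv M s                                      ≡⟨ Uinv-sum M s ⟩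
    sumₚ M (λ p → coeff s p ·ₚ basis p (M ∸ p ∸ 1)) ≈⟨ sumₚ-cong M (λ p _ → ·ₚ-cong (at s≋t p) ≋-refl) ⟩
    sumₚ M (λ p → coeff t p ·ₚ basis p (M ∸ p ∸ 1)) ≡⟨ ≡.sym (Uinv-sum M t) ⟩
    Uinv M t                                      ∎
    where open ≋-Reasoning

  ∸-step : ∀ {p N} → p < N → suc N ∸ p ∸ 1 ≡ suc (N ∸ p ∸ 1)
  ∸-step {zero}  {suc N} _         = ≡.refl
  ∸-step {suc p} {suc N} (s≤s p<N) = ∸-step p<N

  ∸-complement : ∀ {p N} → p < N → suc p ℕ.+ suc (N ∸ p ∸ 1) ≡ suc N
  ∸-complement {zero}  {suc N} _         = ≡.refl
  ∸-complement {suc p} {suc N} (s≤s p<N) = ≡.cong suc (∸-complement p<N)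

  Uinv-step : ∀ N d → DegLt d N → Uinv (suc N) (oneMinusX *ₚ d) ≋ ι (suc N) ·ₚ Uinv N d
  Uinv-step N d deg = begin
    Uinv (suc N) (oneMinusX *ₚ d)                            ≡⟨ Uinv-sum (suc N) (oneMinusX *ₚ d) ⟩
    sumₚ (suc N) (λ p → coeff (oneMinusX *ₚ d) p ·ₚ G p)    ≈⟨ sumₚ-cong (suc N) {λ p → coeff (oneMinusX *ₚ d) p ·ₚ G p} {λ p → Δ (coeff d) p ·ₚ G p}
                                                                   (λ p _ → ·ₚ-cong (coeff-oneMinusX* d p) (≋-refl {G p})) ⟩
    sumₚ (suc N) (λ p → Δ (coeff d) p ·ₚ G p)               ≈⟨ summation-by-parts N (coeff d) G H recurrence ⟩
    sumₚ N (λ p → coeff d p ·ₚ H p) +ₚ coeff d N ·ₚ G N      ≈⟨ +ₚ-cong ≋-refl (·ₚ-zero (G N) (deg N ≤-refl)) ⟩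
    sumₚ N (λ p → coeff d p ·ₚ H p) +ₚ []                    ≈⟨ +ₚ-identityʳ _ ⟩
    sumₚ N (λ p → coeff d p ·ₚ H p)                          ≈⟨ sumₚ-cong N (λ p _ → ·ₚ-comm (coeff d p) (ι (suc N)) (B p)) ⟩
    sumₚ N (λ p → ι (suc N) ·ₚ (coeff d p ·ₚ B p))           ≈⟨ ≋-sym (sumₚ-· N (ι (suc N)) (λ p → coeff d p ·ₚ B p)) ⟩
    ι (suc N) ·ₚ sumₚ N (λ p → coeff d p ·ₚ B p)             ≡⟨ ≡.cong (ι (suc N) ·ₚ_) (≡.sym (Uinv-sum N d)) ⟩
    ι (suc N) ·ₚ Uinv N d                                    ∎
    where
    open ≋-Reasoning
    G B H : ℕ → Pol
    G p = basis p (suc N ∸ p ∸ 1)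
    B p = basis p (N ∸ p ∸ 1)
    H p = ι (suc N) ·ₚ B p
    recurrence : ∀ p → p < N → G p ≋ G (suc p) +ₚ H p
    recurrence p p<N = begin
      basis p (suc N ∸ p ∸ 1)                            ≡⟨ ≡.cong (basis p) (∸-step p<N) ⟩
      basis p (suc q)                                    ≈⟨ basis-recurrence p q ⟩
      basis (suc p) q +ₚ ι (suc p ℕ.+ suc q) ·ₚ B p      ≡⟨ ≡.cong (λ n → G (suc p) +ₚ ι n ·ₚ B p) (∸-complement p<N) ⟩
      G (suc p) +ₚ H p                                   ∎
      where q = N ∸ p ∸ 1

  Uinv-factor : Reciprocals → ∀ m N c → DegLt c N →
    Uinv (m ℕ.+ N) (oneMinusX ^ₚ m *ₚ c) ≋ (ι ((m ℕ.+ N) !) * invfact N) ·ₚ Uinv N c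
  Uinv-factor inverse zero N c deg = begin
    Uinv N (oneₚ *ₚ c)                 ≈⟨ Uinv-cong N (*ₚ-identityˡ c) ⟩
    Uinv N c                           ≈⟨ ≋-sym (·ₚ-identity (Uinv N c)) ⟩
    1# ·ₚ Uinv N c                     ≈⟨ ·ₚ-cong (sym (ι!-invfact inverse N)) ≋-refl ⟩
    (ι (N !) * invfact N) ·ₚ Uinv N c  ∎
    where open ≋-Reasoning
  Uinv-factor inverse (suc m) N c deg = begin
    Uinv (suc k) ((oneMinusX *ₚ oneMinusX ^ₚ m) *ₚ c)       ≈⟨ Uinv-cong (suc k) (*ₚ-assoc oneMinusX (oneMinusX ^ₚ m) c) ⟩
    Uinv (suc k) (oneMinusX *ₚ (oneMinusX ^ₚ m *ₚ c))       ≈⟨ Uinv-step k (oneMinusX ^ₚ m *ₚ c) (DegLt-oneMinusX^* m N c deg) ⟩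
    ι (suc k) ·ₚ Uinv k (oneMinusX ^ₚ m *ₚ c)              ≈⟨ ·ₚ-cong refl (Uinv-factor inverse m N c deg) ⟩
    ι (suc k) ·ₚ ((ι (k !) * invfact N) ·ₚ Uinv N c)       ≈⟨ ·ₚ-assoc (ι (suc k)) _ (Uinv N c) ⟩
    (ι (suc k) * (ι (k !) * invfact N)) ·ₚ Uinv N c        ≈⟨ ·ₚ-cong constants ≋-refl ⟩
    (ι (suc k !) * invfact N) ·ₚ Uinv N c                  ∎
    where
    open ≋-Reasoning
    k = m ℕ.+ N
    constants : ι (suc k) * (ι (k !) * invfact N) ≈ ι (suc k !) * invfact N
    constants = trans (sym (*-assoc _ _ _)) (*-cong (sym (ι-* (suc k) (k !))) refl)

<⇒+suc : ∀ {m n} → m < n → Σ[ k ∈ ℕ ] n ≡ m ℕ.+ suc k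
<⇒+suc {zero}  {suc n} _         = n , ≡.refl
<⇒+suc {suc m} {suc n} (s≤s m<n) with <⇒+suc m<n
... | k , n≡m+1+k = k , ≡.cong suc n≡m+1+k

-- With n = m + N, N = k + 1: both halves are the factorisation lemmas above,
-- since deg s = N - 1 gives deg s < N.
theorem3 : ∀ {c ℓ} (R : CommutativeRing c ℓ) (recip : ℕ → CommutativeRing.Carrier R) →
    let open CommutativeRing R
        open Poly R recip
    in
    (∀ k → ι (suc k) * recip k ≈ 1#) →
    (m n : ℕ) → m < n →
    ((s : Pol) → HasDegree s (n ∸ m ∸ 1) →
      U n s ≈ₚ (oneMinusX ^ₚ m) *ₚ ((ι ((n ∸ m) !) * invfact n) ·ₚ U (n ∸ m) s))
    ×
    ((cp : Pol) → DegLt cp (n ∸ m) →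
      Uinv n ((oneMinusX ^ₚ m) *ₚ cp) ≈ₚ (ι (n !) * invfact (n ∸ m)) ·ₚ Uinv (n ∸ m) cp)
theorem3 R recip inverse m n m<n with <⇒+suc m<n
... | k , ≡.refl rewrite m+n∸m≡n m (suc k) =
    (λ s deg-s → at (U-factor inverse m (suc k) s (proj₂ deg-s)))
  , (λ c deg-c → at (Uinv-factor inverse m (suc k) c deg-c))
  where open Development R recip
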